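{- Over the logic $\Gamma(\mathbf{LS},1,2)$, every modal formula $\varphi$ with $v^+(\varphi)\subseteq\{p\}$ and $v^-(\varphi)=\emptyset$ is provably equivalent to one of the eight formulas $\bot$, $\Box p$, $p\land\Box\Diamond p$, $\Box\Diamond p$, $p$, $p\lor\Box\Diamond p$, $\Diamond p$, $\top$.
   Context: Modal formulas use variables, $\bot,\land,\lor,\neg,\to,\Box$, with $\Diamond\varphi:=\neg\Box\neg\varphi$ and $\top:=\neg\bot$. Positive/negative variables: $v^+(p)=\{p\}$, $v^-(p)=\emptyset$, $v^\circ(\bot)=\emptyset$, $\land,\lor,\Box$ preserve polarity ($v^\circ(\varphi\ast\psi)=v^\circ(\varphi)\cup v^\circ(\psi)$, $v^\circ(\Box\varphi)=v^\circ(\varphi)$), $v^\pm(\neg\varphi)=v^\mp(\varphi)$, $v^+(\varphi\to\psi)=v^-(\varphi)\cup v^+(\psi)$, $v^-(\varphi\to\psi)=v^+(\varphi)\cup v^-(\psi)$. $\Gamma(\mathbf{LS},1,2)$ is the set of modal formulas true at every world of every Kripke model on the frame $(W,R)$ with $W=\{a,b,c\}$ and $R$ the reflexive transitive closure of $\{(a,b),(b,a),(a,c),(b,c)\}$ (a two-element cluster below a single final point). "Provably equivalent over $L$" means $L\vdash\varphi\leftrightarrow\psi$. -}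

module Defs where

open import Data.Nat using (ℕ)
open import Data.Bool using (Bool; true; false; _∧_; _∨_; not)
open import Data.List using (List; []; _∷_; _++_)
open import Data.Fin using (Fin; zero; suc)
open import Relation.Binary.PropositionalEquality using (_≡_)

data Fm : Set where
  var  : ℕ → Fm
  ⊥'   : Fm
  _∧'_ : Fm → Fm → Fm
  _∨'_ : Fm → Fm → Fm
  ¬'_  : Fm → Fm
  _⇒_  : Fm → Fm → Fm
  □_   : Fm → Fm

◇_ : Fm → Fm
◇ φ = ¬' (□ (¬' φ))

⊤' : Fm
⊤' = ¬' ⊥'

_⇔_ : Fm → Fm → Fm
φ ⇔ ψ = (φ ⇒ ψ) ∧' (ψ ⇒ φ)

p : Fm
p = var 0

-- positive / negative variables (as lists; set = list up to repetition)
mutual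
  v⁺ : Fm → List ℕ
  v⁺ (var x)   = x ∷ []
  v⁺ ⊥'        = []
  v⁺ (φ ∧' ψ)  = v⁺ φ ++ v⁺ ψ
  v⁺ (φ ∨' ψ)  = v⁺ φ ++ v⁺ ψ
  v⁺ (¬' φ)    = v⁻ φ
  v⁺ (φ ⇒ ψ)   = v⁻ φ ++ v⁺ ψ
  v⁺ (□ φ)     = v⁺ φ

  v⁻ : Fm → List ℕ
  v⁻ (var x)   = []
  v⁻ ⊥'        = []
  v⁻ (φ ∧' ψ)  = v⁻ φ ++ v⁻ ψ
  v⁻ (φ ∨' ψ)  = v⁻ φ ++ v⁻ ψ
  v⁻ (¬' φ)    = v⁺ φ
  v⁻ (φ ⇒ ψ)   = v⁺ φ ++ v⁻ ψ
  v⁻ (□ φ)     = v⁻ φ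

-- The frame LS(1,2): worlds a, b (a two-element cluster) below the final point c.
data W : Set where
  a b c : W

-- R = reflexive transitive closure of {(a,b),(b,a),(a,c),(b,c)}
R : W → W → Bool
R a _ = true
R b _ = true
R c a = false
R c b = false
R c c = true

⟦_⟧ : Fm → (ℕ → W → Bool) → W → Bool
⟦ var x ⟧ V w  = V x w
⟦ ⊥' ⟧ V w     = false
⟦ φ ∧' ψ ⟧ V w = ⟦ φ ⟧ V w ∧ ⟦ ψ ⟧ V w
⟦ φ ∨' ψ ⟧ V w = ⟦ φ ⟧ V w ∨ ⟦ ψ ⟧ V w
⟦ ¬' φ ⟧ V w   = not (⟦ φ ⟧ V w)
⟦ φ ⇒ ψ ⟧ V w  = not (⟦ φ ⟧ V w) ∨ ⟦ ψ ⟧ V w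
⟦ □ φ ⟧ V w    = (not (R w a) ∨ ⟦ φ ⟧ V a)
               ∧ ((not (R w b) ∨ ⟦ φ ⟧ V b)
               ∧ (not (R w c) ∨ ⟦ φ ⟧ V c))

Γ-LS12 : Fm → Set
Γ-LS12 φ = (V : ℕ → W → Bool) (w : W) → ⟦ φ ⟧ V w ≡ true

⊢Γ : Fm → Set
⊢Γ χ = Γ-LS12 χ

eight : Fin 8 → Fm
eight zero = ⊥'
eight (suc zero) = □ p
eight (suc (suc zero)) = p ∧' (□ (◇ p))
eight (suc (suc (suc zero))) = □ (◇ p)
eight (suc (suc (suc (suc zero)))) = p
eight (suc (suc (suc (suc (suc zero))))) = p ∨' (□ (◇ p))
eight (suc (suc (suc (suc (suc (suc zero)))))) = ◇ p
eight (suc (suc (suc (suc (suc (suc (suc zero))))))) = ⊤'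

{-# OPTIONS --safe #-}
-- On this three-world frame a formula whose only variable is p is determined by its
-- denotation, the map sending the truth set of p to the truth set of the formula. The
-- denotations of the eight formulas include those of ⊥ and p and are closed under ∧, ∨, □
-- and ◇, which is a finite check; by De Morgan duality their complements are closed under
-- ∧, ∨ and □. Induction on φ, treating positive formulas (denotation among the eight)
-- together with negative ones (complement of one of the eight), proves the theorem.
module Submission where

open import Defs
open import Data.Nat using (ℕ)
open import Data.Fin using (Fin; zero; suc)
open import Data.Fin.Properties using (all?; any?)
open import Data.List using (List; []; _++_)
open import Data.List.Properties using (++-conicalˡ; ++-conicalʳ)
open import Data.List.Relation.Unary.All using (All; []; _∷_)
open import Data.List.Relation.Unary.All.Properties using (++⁻ˡ; ++⁻ʳ)
open import Data.Product using (Σ; ∃-syntax; _×_; _,_; proj₂; map₂)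
open import Data.Bool using (Bool; true; false; _∧_; _∨_; not)
open import Data.Bool.Properties using (not-involutive; ∨-inverseˡ; ∨-∧-booleanAlgebra)
  renaming (_≟_ to _≟ᵇ_)
open import Algebra.Lattice.Properties.BooleanAlgebra ∨-∧-booleanAlgebra
  using (deMorgan₁; deMorgan₂)
open import Relation.Nullary.Decidable using (Dec; map′; _×-dec_; from-yes)
open import Relation.Binary.PropositionalEquality using (_≡_; refl; sym; trans; cong; cong₂)

Polar : List ℕ → List ℕ → Set
Polar xs ys = All (_≡ 0) xs × ys ≡ []

Positive Negative : Fm → Set
Positive φ = Polar (v⁺ φ) (v⁻ φ)
Negative φ = Polar (v⁻ φ) (v⁺ φ)

Polar-++⁻ˡ : ∀ xs {xs′} ys {ys′} → Polar (xs ++ xs′) (ys ++ ys′) → Polar xs ys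
Polar-++⁻ˡ xs ys (all , none) = ++⁻ˡ xs all , ++-conicalˡ ys _ none

Polar-++⁻ʳ : ∀ xs {xs′} ys {ys′} → Polar (xs ++ xs′) (ys ++ ys′) → Polar xs′ ys′
Polar-++⁻ʳ xs ys (all , none) = ++⁻ʳ xs all , ++-conicalʳ ys _ none

□ʷ : (W → Bool) → W → Bool
□ʷ P w = (not (R w a) ∨ P a) ∧ ((not (R w b) ∨ P b) ∧ (not (R w c) ∨ P c))

□ʷ-cong : ∀ {P Q} → (∀ w → P w ≡ Q w) → ∀ w → □ʷ P w ≡ □ʷ Q w
□ʷ-cong P≡Q w = cong₂ _∧_ (cong (not (R w a) ∨_) (P≡Q a))
  (cong₂ _∧_ (cong (not (R w b) ∨_) (P≡Q b)) (cong (not (R w c) ∨_) (P≡Q c)))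

-- The arguments are the truth values of p at a, b and c.
Denotation : Set
Denotation = Bool → Bool → Bool → W → Bool

variable
  φ ψ : Fm
  f g : Denotation

infix  4 _≐_ _denotes_
infixr 7 _∧ᴰ_
infixr 6 _∨ᴰ_

_≐_ : Denotation → Denotation → Set
f ≐ g = ∀ x y z w → f x y z w ≡ g x y z w

_∧ᴰ_ _∨ᴰ_ : Denotation → Denotation → Denotation
(f ∧ᴰ g) x y z w = f x y z w ∧ g x y z w
(f ∨ᴰ g) x y z w = f x y z w ∨ g x y z w

¬ᴰ_ □ᴰ_ ◇ᴰ_ : Denotation → Denotation
(¬ᴰ f) x y z w = not (f x y z w)
(□ᴰ f) x y z = □ʷ (f x y z)
◇ᴰ f = ¬ᴰ □ᴰ ¬ᴰ f

-- Every variable is interpreted as p; only p occurs in the formulas of interest.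
valuation : Bool → Bool → Bool → ℕ → W → Bool
valuation x y z _ a = x
valuation x y z _ b = y
valuation x y z _ c = z

⟦_⟧ᴰ : Fm → Denotation
⟦ φ ⟧ᴰ x y z = ⟦ φ ⟧ (valuation x y z)

eightᴰ : Fin 8 → Denotation
eightᴰ i = ⟦ eight i ⟧ᴰ

record _denotes_ (φ : Fm) (f : Denotation) : Set where
  constructor denoting
  field truth : ∀ V w → ⟦ φ ⟧ V w ≡ f (V 0 a) (V 0 b) (V 0 c) w

denotes-resp : φ denotes f → f ≐ g → φ denotes g
denotes-resp (denoting φ≈f) f≐g = denoting λ V w → trans (φ≈f V w) (f≐g _ _ _ w)

∧-denotes : φ denotes f → ψ denotes g → φ ∧' ψ denotes f ∧ᴰ g
∧-denotes (denoting φ≈f) (denoting ψ≈g) = denoting λ V w → cong₂ _∧_ (φ≈f V w) (ψ≈g V w)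

∨-denotes : φ denotes f → ψ denotes g → φ ∨' ψ denotes f ∨ᴰ g
∨-denotes (denoting φ≈f) (denoting ψ≈g) = denoting λ V w → cong₂ _∨_ (φ≈f V w) (ψ≈g V w)

⇒-denotes : (¬' φ) ∨' ψ denotes f → φ ⇒ ψ denotes f
⇒-denotes (denoting ¬φ∨ψ≈f) = denoting ¬φ∨ψ≈f

¬-denotes : φ denotes f → ¬' φ denotes ¬ᴰ f
¬-denotes (denoting φ≈f) = denoting λ V w → cong not (φ≈f V w)

□-denotes : φ denotes f → □ φ denotes □ᴰ f
□-denotes (denoting φ≈f) = denoting λ V → □ʷ-cong (φ≈f V)

denotes-canonical : φ denotes f → φ denotes ⟦ φ ⟧ᴰ
denotes-canonical (denoting φ≈f) = denoting λ V w →
  trans (φ≈f V w) (sym (φ≈f (valuation (V 0 a) (V 0 b) (V 0 c)) w))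

p-denotes : p denotes ⟦ p ⟧ᴰ
p-denotes = denoting λ where
  V a → refl
  V b → refl
  V c → refl

∀-Bool? : {P : Bool → Set} → (∀ x → Dec (P x)) → Dec (∀ x → P x)
∀-Bool? P? = map′ (λ { (pt , pf) true → pt ; (pt , pf) false → pf })
  (λ h → h true , h false) (P? true ×-dec P? false)

∀-W? : {P : W → Set} → (∀ w → Dec (P w)) → Dec (∀ w → P w)
∀-W? P? = map′ (λ { (pa , pb , pc) a → pa ; (pa , pb , pc) b → pb ; (pa , pb , pc) c → pc })
  (λ h → h a , h b , h c) (P? a ×-dec P? b ×-dec P? c)

_≐?_ : (f g : Denotation) → Dec (f ≐ g)
f ≐? g = ∀-Bool? λ x → ∀-Bool? λ y → ∀-Bool? λ z → ∀-W? λ w → f x y z w ≟ᵇ g x y z w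

Closed₁ : (Denotation → Denotation) → Set
Closed₁ F = ∀ i → ∃[ k ] F (eightᴰ i) ≐ eightᴰ k

Closed₂ : (Denotation → Denotation → Denotation) → Set
Closed₂ _⊙_ = ∀ i j → ∃[ k ] (eightᴰ i ⊙ eightᴰ j) ≐ eightᴰ k

closed₁? : ∀ F → Dec (Closed₁ F)
closed₁? F = all? λ i → any? λ k → F (eightᴰ i) ≐? eightᴰ k

closed₂? : ∀ _⊙_ → Dec (Closed₂ _⊙_)
closed₂? _⊙_ = all? λ i → all? λ j → any? λ k → (eightᴰ i ⊙ eightᴰ j) ≐? eightᴰ k

-- Opaque, so that later unification never re-runs the exhaustive search.
opaque
  ∧-closed : Closed₂ _∧ᴰ_
  ∧-closed = from-yes (closed₂? _∧ᴰ_)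

  ∨-closed : Closed₂ _∨ᴰ_
  ∨-closed = from-yes (closed₂? _∨ᴰ_)

  □-closed : Closed₁ □ᴰ_
  □-closed = from-yes (closed₁? □ᴰ_)

  ◇-closed : Closed₁ ◇ᴰ_
  ◇-closed = from-yes (closed₁? ◇ᴰ_)

Eight CoEight : Fm → Set
Eight   φ = ∃[ i ] φ denotes eightᴰ i
CoEight φ = ∃[ i ] φ denotes ¬ᴰ eightᴰ i

⊥-eight : Eight ⊥'
⊥-eight = zero , denoting λ V w → refl

⊥-coeight : CoEight ⊥'
⊥-coeight = suc (suc (suc (suc (suc (suc (suc zero)))))) , denoting λ V w → refl

p-eight : Eight p
p-eight = suc (suc (suc (suc zero))) , p-denotes

∧-eight : Eight φ → Eight ψ → Eight (φ ∧' ψ)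
∧-eight (i , φ≈i) (j , ψ≈j) with ∧-closed i j
... | k , ij≐k = k , denotes-resp (∧-denotes φ≈i ψ≈j) ij≐k

∨-eight : Eight φ → Eight ψ → Eight (φ ∨' ψ)
∨-eight (i , φ≈i) (j , ψ≈j) with ∨-closed i j
... | k , ij≐k = k , denotes-resp (∨-denotes φ≈i ψ≈j) ij≐k

∧-coeight : CoEight φ → CoEight ψ → CoEight (φ ∧' ψ)
∧-coeight (i , φ≈¬i) (j , ψ≈¬j) with ∨-closed i j
... | k , ij≐k = k , denotes-resp (∧-denotes φ≈¬i ψ≈¬j)
  λ x y z w → trans (sym (deMorgan₂ (eightᴰ i x y z w) (eightᴰ j x y z w)))
                    (cong not (ij≐k x y z w))

∨-coeight : CoEight φ → CoEight ψ → CoEight (φ ∨' ψ)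
∨-coeight (i , φ≈¬i) (j , ψ≈¬j) with ∧-closed i j
... | k , ij≐k = k , denotes-resp (∨-denotes φ≈¬i ψ≈¬j)
  λ x y z w → trans (sym (deMorgan₁ (eightᴰ i x y z w) (eightᴰ j x y z w)))
                    (cong not (ij≐k x y z w))

¬-eight : CoEight φ → Eight (¬' φ)
¬-eight (i , φ≈¬i) = i , denotes-resp (¬-denotes φ≈¬i)
  λ x y z w → not-involutive (eightᴰ i x y z w)

¬-coeight : Eight φ → CoEight (¬' φ)
¬-coeight (i , φ≈i) = i , ¬-denotes φ≈i

□-eight : Eight φ → Eight (□ φ)
□-eight (i , φ≈i) with □-closed i
... | k , i≐k = k , denotes-resp (□-denotes φ≈i) i≐k

□-coeight : CoEight φ → CoEight (□ φ)
□-coeight (i , φ≈¬i) with ◇-closed i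
... | k , i≐k = k , denotes-resp (□-denotes φ≈¬i)
  λ x y z w → trans (sym (not-involutive ((□ᴰ ¬ᴰ eightᴰ i) x y z w)))
                    (cong not (i≐k x y z w))

⇒-eight : CoEight φ → Eight ψ → Eight (φ ⇒ ψ)
⇒-eight φ̄ ψ̄ = map₂ ⇒-denotes (∨-eight (¬-eight φ̄) ψ̄)

⇒-coeight : Eight φ → CoEight ψ → CoEight (φ ⇒ ψ)
⇒-coeight φ̄ ψ̄ = map₂ ⇒-denotes (∨-coeight (¬-coeight φ̄) ψ̄)

mutual
  positive-eight : ∀ φ → Positive φ → Eight φ
  positive-eight (var .0) (refl ∷ [] , _) = p-eight
  positive-eight ⊥' _ = ⊥-eight
  positive-eight (φ ∧' ψ) h = ∧-eight (positive-eight φ (Polar-++⁻ˡ (v⁺ φ) (v⁻ φ) h))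
                                      (positive-eight ψ (Polar-++⁻ʳ (v⁺ φ) (v⁻ φ) h))
  positive-eight (φ ∨' ψ) h = ∨-eight (positive-eight φ (Polar-++⁻ˡ (v⁺ φ) (v⁻ φ) h))
                                      (positive-eight ψ (Polar-++⁻ʳ (v⁺ φ) (v⁻ φ) h))
  positive-eight (φ ⇒ ψ) h = ⇒-eight (negative-coeight φ (Polar-++⁻ˡ (v⁻ φ) (v⁺ φ) h))
                                     (positive-eight ψ (Polar-++⁻ʳ (v⁻ φ) (v⁺ φ) h))
  positive-eight (¬' φ) h = ¬-eight (negative-coeight φ h)
  positive-eight (□ φ) h = □-eight (positive-eight φ h)

  negative-coeight : ∀ φ → Negative φ → CoEight φ
  negative-coeight (var x) (_ , ())
  negative-coeight ⊥' _ = ⊥-coeight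
  negative-coeight (φ ∧' ψ) h = ∧-coeight (negative-coeight φ (Polar-++⁻ˡ (v⁻ φ) (v⁺ φ) h))
                                          (negative-coeight ψ (Polar-++⁻ʳ (v⁻ φ) (v⁺ φ) h))
  negative-coeight (φ ∨' ψ) h = ∨-coeight (negative-coeight φ (Polar-++⁻ˡ (v⁻ φ) (v⁺ φ) h))
                                          (negative-coeight ψ (Polar-++⁻ʳ (v⁻ φ) (v⁺ φ) h))
  negative-coeight (φ ⇒ ψ) h = ⇒-coeight (positive-eight φ (Polar-++⁻ˡ (v⁺ φ) (v⁻ φ) h))
                                         (negative-coeight ψ (Polar-++⁻ʳ (v⁺ φ) (v⁻ φ) h))
  negative-coeight (¬' φ) h = ¬-coeight (positive-eight φ h)
  negative-coeight (□ φ) h = □-coeight (negative-coeight φ h)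

eight-positive : ∀ i → Positive (eight i)
eight-positive zero = [] , refl
eight-positive (suc zero) = refl ∷ [] , refl
eight-positive (suc (suc zero)) = refl ∷ refl ∷ [] , refl
eight-positive (suc (suc (suc zero))) = refl ∷ [] , refl
eight-positive (suc (suc (suc (suc zero)))) = refl ∷ [] , refl
eight-positive (suc (suc (suc (suc (suc zero))))) = refl ∷ refl ∷ [] , refl
eight-positive (suc (suc (suc (suc (suc (suc zero)))))) = refl ∷ [] , refl
eight-positive (suc (suc (suc (suc (suc (suc (suc zero))))))) = [] , refl

eight-denotes : ∀ i → eight i denotes eightᴰ i
eight-denotes i = denotes-canonical (proj₂ (positive-eight (eight i) (eight-positive i)))

⇔-true : ∀ {x y} → x ≡ y → (not x ∨ y) ∧ (not y ∨ x) ≡ true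
⇔-true {x} refl = cong₂ _∧_ (∨-inverseˡ x) (∨-inverseˡ x)

same-denotation⇒⇔-valid : φ denotes f → ψ denotes f → ⊢Γ (φ ⇔ ψ)
same-denotation⇒⇔-valid (denoting φ≈f) (denoting ψ≈f) V w =
  ⇔-true (trans (φ≈f V w) (sym (ψ≈f V w)))

lemma9p1 : (φ : Fm) → All (λ x → x ≡ 0) (v⁺ φ) → v⁻ φ ≡ [] →
    Σ (Fin 8) (λ i → ⊢Γ (φ ⇔ eight i))
lemma9p1 φ h⁺ h⁻ with positive-eight φ (h⁺ , h⁻)
... | i , φ≈i = i , same-denotation⇒⇔-valid φ≈i (eight-denotes i)
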